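{- Let $a<b$ be positive odd integers and let $w$ be an infinite smooth word over $\{a,b\}$. If $w$ starts with the letter $a$, then every block of $a$'s in $w$ starts at an even position and every block of $b$'s starts at an odd position. If $w$ starts with the letter $b$, then every block of $a$'s starts at an odd position and every block of $b$'s starts at an even position.
   Context: Positions in $w=w[0]w[1]\cdots$ are indexed from $0$. A block is a maximal factor of the form $\alpha^k$ with $\alpha$ a letter. For a word $w$ over $\{a,b\}$ written as maximal blocks $\alpha_0^{i_0}\alpha_1^{i_1}\cdots$, $\Delta(w)=i_0i_1\cdots$; an infinite word $w\in\{a,b\}^\omega$ is smooth if $\Delta^k(w)\in\{a,b\}^\omega$ for all $k\ge0$. -}

module Defs where

open import Data.Nat using (ℕ; zero; suc; _+_; _*_; _∸_; _≤_; _<_)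
open import Data.Product using (Σ; ∃; _×_; _,_)
open import Data.Sum using (_⊎_)
open import Data.Unit using (⊤)
open import Relation.Binary.PropositionalEquality using (_≡_; _≢_)

-- Infinite words: letters are natural numbers, positions indexed from 0.
Word : Set
Word = ℕ → ℕ

Even : ℕ → Set
Even n = ∃ λ k → n ≡ 2 * k

Odd : ℕ → Set
Odd n = ∃ λ k → n ≡ suc (2 * k)

OverAB : ℕ → ℕ → Word → Set
OverAB a b w = ∀ i → (w i ≡ a) ⊎ (w i ≡ b)

-- IsDelta w v : w has infinitely many maximal blocks and v = Δ(w),
-- i.e. s k is the start position of the k-th block, s 0 = 0,
-- w is constant on [s k, s (k+1)), the letter changes at s (k+1),
-- and v k = s (k+1) - s k is the length of the k-th block.
IsDelta : Word → Word → Set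
IsDelta w v =
  Σ (ℕ → ℕ) λ s →
    (s 0 ≡ 0)
    × (∀ k → s k < s (suc k))
    × (∀ k i → s k ≤ i → i < s (suc k) → w i ≡ w (s k))
    × (∀ k → w (s (suc k)) ≢ w (s k))
    × (∀ k → v k ≡ s (suc k) ∸ s k)

-- w is smooth over {a,b}: Δ^k(w) ∈ {a,b}^ω for all k.
-- W k is Δ^k(w) (Δ is uniquely determined, so the existential is faithful).
Smooth : ℕ → ℕ → Word → Set
Smooth a b w =
  Σ (ℕ → Word) λ W →
    (∀ i → W 0 i ≡ w i)
    × (∀ k → OverAB a b (W k))
    × (∀ k → IsDelta (W k) (W (suc k)))

BlockStart : Word → ℕ → Set
BlockStart w zero = ⊤
BlockStart w (suc p) = w (suc p) ≢ w p

-- Block starts therefore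
-- alternate in parity, and since w is over two letters they also alternate
-- between the letter w 0 and the other one.  Hence a block start p carries
-- the letter w 0 exactly when p is even.
module Submission where

open import Defs
open import Data.Nat using (ℕ; zero; suc; _+_; _*_; _∸_; _≤_; _<_; z≤n)
open import Data.Nat.Properties
  using (+-suc; *-suc; *-distribˡ-+; <⇒≤; <⇒≢; m+[n∸m]≡n; m≤n⇒m<n∨m≡n; ≤-refl; ≤-trans; n≤1+n)
open import Data.Product using (_×_; _,_; ∃; proj₁; proj₂; swap)
open import Data.Sum using (_⊎_; inj₁; inj₂)
open import Data.Empty using (⊥-elim)
open import Function using (const)
open import Relation.Binary.PropositionalEquality

even+odd⇒odd : ∀ {m n} → Even m → Odd n → Odd (m + n)
even+odd⇒odd (k , refl) (j , refl) = k + j , (begin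
    2 * k + suc (2 * j)  ≡⟨ +-suc (2 * k) (2 * j) ⟩
    suc (2 * k + 2 * j)  ≡⟨ cong suc (*-distribˡ-+ 2 k j) ⟨
    suc (2 * (k + j))    ∎)
  where open ≡-Reasoning

odd+odd⇒even : ∀ {m n} → Odd m → Odd n → Even (m + n)
odd+odd⇒even (k , refl) on with even+odd⇒odd (k , refl) on
... | j , eq = suc j , trans (cong suc eq) (sym (*-suc 2 j))

twoLetters-≢-≢⇒≡ : ∀ {a b x y z : ℕ} →
  (x ≡ a) ⊎ (x ≡ b) → (y ≡ a) ⊎ (y ≡ b) → (z ≡ a) ⊎ (z ≡ b) →
  x ≢ y → y ≢ z → x ≡ z
twoLetters-≢-≢⇒≡ (inj₁ refl) _           (inj₁ refl) _   _   = refl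
twoLetters-≢-≢⇒≡ (inj₂ refl) _           (inj₂ refl) _   _   = refl
twoLetters-≢-≢⇒≡ (inj₁ refl) (inj₁ refl) (inj₂ refl) x≢y _   = ⊥-elim (x≢y refl)
twoLetters-≢-≢⇒≡ (inj₁ refl) (inj₂ refl) (inj₂ refl) _   y≢z = ⊥-elim (y≢z refl)
twoLetters-≢-≢⇒≡ (inj₂ refl) (inj₁ refl) (inj₁ refl) _   y≢z = ⊥-elim (y≢z refl)
twoLetters-≢-≢⇒≡ (inj₂ refl) (inj₂ refl) (inj₁ refl) x≢y _   = ⊥-elim (x≢y refl)

BlockStart-resp : ∀ {u w : Word} → (∀ i → u i ≡ w i) → ∀ p → BlockStart w p → BlockStart u p
BlockStart-resp u≗w zero    _  = _
BlockStart-resp u≗w (suc p) bs = λ eq → bs (trans (sym (u≗w (suc p))) (trans eq (u≗w p)))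

module Blocks {w v : Word} (δ : IsDelta w v) where

  s : ℕ → ℕ
  s = proj₁ δ

  private
    s-zero : s 0 ≡ 0
    s-zero = proj₁ (proj₂ δ)

    s-inc : ∀ k → s k < s (suc k)
    s-inc = proj₁ (proj₂ (proj₂ δ))

    s-const : ∀ k i → s k ≤ i → i < s (suc k) → w i ≡ w (s k)
    s-const = proj₁ (proj₂ (proj₂ (proj₂ δ)))

    s-change : ∀ k → w (s (suc k)) ≢ w (s k)
    s-change = proj₁ (proj₂ (proj₂ (proj₂ (proj₂ δ))))

    v-length : ∀ k → v k ≡ s (suc k) ∸ s k
    v-length = proj₂ (proj₂ (proj₂ (proj₂ (proj₂ δ))))

  start-suc : ∀ k → s (suc k) ≡ s k + v k
  start-suc k = trans (sym (m+[n∸m]≡n (<⇒≤ (s-inc k)))) (cong (s k +_) (sym (v-length k)))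

  blockContaining : ∀ q → ∃ λ k → s k ≤ q × q < s (suc k)
  blockContaining zero = 0 , subst (_≤ 0) (sym s-zero) z≤n , subst (_< s 1) s-zero (s-inc 0)
  blockContaining (suc q) with blockContaining q
  ... | k , sk≤q , q<sk+1 with m≤n⇒m<n∨m≡n q<sk+1
  ... | inj₁ q+1<sk+1 = k , ≤-trans sk≤q (n≤1+n q) , q+1<sk+1
  ... | inj₂ q+1≡sk+1 = suc k , subst (_≤ suc q) q+1≡sk+1 ≤-refl
                              , subst (_< s (suc (suc k))) (sym q+1≡sk+1) (s-inc (suc k))

  blockStart⇒start : ∀ p → BlockStart w p → ∃ λ k → s k ≡ p
  blockStart⇒start zero    _  = 0 , s-zero
  blockStart⇒start (suc q) bs with blockContaining q
  ... | k , sk≤q , q<sk+1 with m≤n⇒m<n∨m≡n q<sk+1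
  ... | inj₂ q+1≡sk+1 = suc k , sym q+1≡sk+1
  ... | inj₁ q+1<sk+1 = ⊥-elim (bs (trans (s-const k (suc q) (≤-trans sk≤q (n≤1+n q)) q+1<sk+1)
                                          (sym (s-const k q sk≤q q<sk+1))))

  start-parity : ∀ {a b} → OverAB a b w → (∀ k → Odd (v k)) →
    ∀ k → (Even (s k) × w (s k) ≡ w 0) ⊎ (Odd (s k) × w (s k) ≢ w 0)
  start-parity ab odd zero rewrite s-zero = inj₁ ((0 , refl) , refl)
  start-parity ab odd (suc k) with start-parity ab odd k
  ... | inj₁ (e , same) = inj₂ (subst Odd (sym (start-suc k)) (even+odd⇒odd e (odd k)) ,
                                λ eq → s-change k (trans eq (sym same)))
  ... | inj₂ (o , diff) = inj₁ (subst Even (sym (start-suc k)) (odd+odd⇒even o (odd k)) ,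
                                twoLetters-≢-≢⇒≡ (ab (s (suc k))) (ab (s k)) (ab 0) (s-change k) diff)

  blockStart-parity : ∀ {a b} → OverAB a b w → (∀ k → Odd (v k)) →
    ∀ p → BlockStart w p → (Even p × w p ≡ w 0) ⊎ (Odd p × w p ≢ w 0)
  blockStart-parity ab odd p bs with blockStart⇒start p bs
  ... | k , refl = start-parity ab odd k

overOddLetters⇒odd : ∀ {a b} {v : Word} → Odd a → Odd b → OverAB a b v → ∀ k → Odd (v k)
overOddLetters⇒odd oa ob ab k with ab k
... | inj₁ refl = oa
... | inj₂ refl = ob

smooth-blockStart-parity : ∀ {a b} {w : Word} → Odd a → Odd b → Smooth a b w →
  ∀ p → BlockStart w p → (Even p × w p ≡ w 0) ⊎ (Odd p × w p ≢ w 0)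
smooth-blockStart-parity oa ob (W , W0≗w , ab , δ) p bs
  with Blocks.blockStart-parity (δ 0) (ab 0) (overOddLetters⇒odd oa ob (ab 1)) p
         (BlockStart-resp W0≗w p bs)
... | inj₁ (e , same) = inj₁ (e , trans (sym (W0≗w p)) (trans same (W0≗w 0)))
... | inj₂ (o , diff) = inj₂ (o , λ eq → diff (trans (W0≗w p) (trans eq (sym (W0≗w 0)))))

lemma24 : (a b : ℕ) → a < b → Odd a → Odd b → (w : Word) → Smooth a b w →
    ((w 0 ≡ a) →
      ∀ p → BlockStart w p → ((w p ≡ a → Even p) × (w p ≡ b → Odd p)))
    × ((w 0 ≡ b) →
      ∀ p → BlockStart w p → ((w p ≡ a → Odd p) × (w p ≡ b → Even p)))
lemma24 a b a<b oa ob w smooth =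
    starting (<⇒≢ a<b)
  , λ w0≡b p bs → swap (starting (≢-sym (<⇒≢ a<b)) w0≡b p bs)
  where
  starting : ∀ {c d} → c ≢ d → w 0 ≡ c →
    ∀ p → BlockStart w p → (w p ≡ c → Even p) × (w p ≡ d → Odd p)
  starting c≢d w0≡c p bs with smooth-blockStart-parity oa ob smooth p bs
  ... | inj₁ (e , same) = const e , λ wp≡d → ⊥-elim (c≢d (trans (sym w0≡c) (trans (sym same) wp≡d)))
  ... | inj₂ (o , diff) = (λ wp≡c → ⊥-elim (diff (trans wp≡c (sym w0≡c)))) , const o
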